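{- For every name $Q$: if $\eta\,Q\,Q$ and $\neg(Q\equiv\mathit{Universe})$, then $\mathit{boundaryM}\,Q \approx \Lambda$.
   Context: Setting: a Coq formalization (classical logic) of Leśniewski's Ontology and Mereology. There is a type $N$ of names and a primitive relation $\eta : N\to N\to\mathrm{Prop}$ satisfying Leśniewski's ontological axiom: $\eta\,A\,b \leftrightarrow \big((\exists C,\ \eta\,C\,A)\wedge(\forall C\,D,\ \eta\,C\,A\wedge\eta\,D\,A\to\eta\,C\,D)\wedge(\forall C,\ \eta\,C\,A\to\eta\,C\,b)\big)$. $A$ is an individual iff $\eta\,A\,A$. For names $a,b$: $\eta\,P\,(a\cap b)\leftrightarrow(\eta\,P\,a\wedge\eta\,P\,b)$; $a\approx b$ means $\forall P,\ \eta\,P\,a\leftrightarrow\eta\,P\,b$; $P\equiv Q$ means $\eta\,P\,Q\wedge\eta\,Q\,P$; $\Lambda$ is the empty name (no $P$ with $\eta\,P\,\Lambda$); $V$ is the universal name ($\eta\,P\,V\leftrightarrow\eta\,P\,P$). Mereology: $pt:N\to N$ ($\eta\,B\,(pt\,A)$: $B$ is a part of $A$) satisfying Leśniewski's mereology axioms (part-of is a partial order on individuals; every non-empty name has a unique m-class). M-class: $\eta\,A\,(klass\,a)$ iff $\eta\,A\,A$, $\forall B,\ \eta\,B\,a\to\eta\,B\,(pt\,A)$, and $\forall B,\ \eta\,B\,(pt\,A)\to\exists C\,D,\ \eta\,C\,a\wedge\eta\,D\,(pt\,C)\wedge\eta\,D\,(pt\,B)$. $\eta\,P\,(ext\,Q)$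 iff $P,Q$ are individuals having no common part. $\eta\,P\,\mathit{Universe}$ iff $\eta\,P\,(klass\,V)$. $\eta\,P\,(\mathit{compl}\,Q)$ iff $\eta\,Q\,(pt\,\mathit{Universe})$ and $\eta\,P\,(klass\,((pt\,\mathit{Universe})\cap(ext\,Q)))$ (mereological complement relative to $\mathit{Universe}$). Interior: $\eta\,P\,(\mathit{interior}\,Q)$ iff $\eta\,Q\,Q\wedge\eta\,P\,Q$. Closure: $\eta\,P\,(\mathit{closure}\,Q)$ iff $\eta\,Q\,Q$ and $\exists R\,S,\ \eta\,R\,(\mathit{compl}\,Q)\wedge\eta\,S\,(\mathit{interior}\,R)\wedge\eta\,P\,(\mathit{compl}\,S)$. Mereological boundary: $\eta\,P\,(\mathit{boundaryM}\,Q)$ iff $\eta\,Q\,Q$ and $\eta\,P\,((\mathit{closure}\,Q)\cap(\mathit{closure}\,(\mathit{compl}\,Q)))$. -}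

module Defs where

open import Level using (Level; suc; _⊔_)
open import Data.Product using (_×_; ∃; ∃₂; _,_)
open import Data.Sum using (_⊎_)
open import Relation.Nullary using (¬_)
open import Function.Bundles using (_⇔_)

-- Leśniewski's Ontology + Mereology, in classical logic.
-- A model is a type of names N with the primitive relation η, satisfying
-- the ontological axiom, together with the name-forming functors of the
-- context, each given by its defining equivalence, and the mereology axioms.

record Mereology : Set₁ where
  field
    N : Set
    η : N → N → Set

    excluded-middle : (P : Set) → P ⊎ ¬ P

    ontology : ∀ A b →
      η A b ⇔ ((∃ λ C → η C A)
               × (∀ C D → η C A → η D A → η C D)
               × (∀ C → η C A → η C b))

    _∩_ : N → N → N
    ∩-def : ∀ P a b → η P (a ∩ b) ⇔ (η P a × η P b)
    Λ : N
    Λ-def : ∀ P → ¬ η P Λ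
    V : N
    V-def : ∀ P → η P V ⇔ η P P

    -- mereology: pt A = the parts (ingredients) of A
    pt : N → N
    pt-ind : ∀ A B → η A (pt B) → η B B
    pt-refl : ∀ A → η A A → η A (pt A)
    pt-antisym : ∀ A B → η A (pt B) → η B (pt A) → η A B
    pt-trans : ∀ A B C → η A (pt B) → η B (pt C) → η A (pt C)

    klass : N → N
    klass-def : ∀ A a → η A (klass a) ⇔
      (η A A
       × (∀ B → η B a → η B (pt A))
       × (∀ B → η B (pt A) → ∃₂ λ C D → η C a × η D (pt C) × η D (pt B)))
    klass-exists : ∀ a → (∃ λ C → η C a) → ∃ λ A → η A (klass a)
    klass-unique : ∀ a A B → η A (klass a) → η B (klass a) → η A B

    ext : N → N
    ext-def : ∀ P Q → η P (ext Q) ⇔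
      (η P P × η Q Q × ¬ (∃ λ C → η C (pt P) × η C (pt Q)))

    Universe : N
    Universe-def : ∀ P → η P Universe ⇔ η P (klass V)

    compl : N → N
    compl-def : ∀ P Q → η P (compl Q) ⇔
      (η Q (pt Universe) × η P (klass ((pt Universe) ∩ (ext Q))))

    interior : N → N
    interior-def : ∀ P Q → η P (interior Q) ⇔ (η Q Q × η P Q)

    closure : N → N
    closure-def : ∀ P Q → η P (closure Q) ⇔
      (η Q Q × ∃₂ λ R S → η R (compl Q) × η S (interior R) × η P (compl S))

    boundaryM : N → N
    boundaryM-def : ∀ P Q → η P (boundaryM Q) ⇔
      (η Q Q × η P ((closure Q) ∩ (closure (compl Q))))

  _≈_ : N → N → Set
  a ≈ b = ∀ P → η P a ⇔ η P b

  _≡ₙ_ : N → N → Set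
  P ≡ₙ Q = η P Q × η Q P

-- Since the interior of a name is that name itself, a closure is a double
-- complement: any P in the closure of Q is the complement of an individual
-- that is the complement of Q. Applying this to both Q and compl Q, a P in
-- the boundary of Q is the complement of compl Q and, simultaneously, the
-- complement of that complement, i.e. of P itself. But nothing is its own
-- complement: P, being its own part, would have to overlap something exterior
-- to P. So the boundary is empty.
module Submission where

open import Defs
open import Data.Empty using (⊥-elim)
open import Data.Product using (_×_; _,_; ∃; proj₁; proj₂)
open import Relation.Nullary using (¬_)
open import Function.Bundles using (mk⇔; Equivalence)
open Equivalence

module _ (M : Mereology) where
  open Mereology M

  η-trans : ∀ {A B c} → η A B → η B c → η A c
  η-trans {A} {B} {c} A∈B B∈c = proj₂ (proj₂ (to (ontology B c) B∈c)) A A∈B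

  η-individual : ∀ {A b} → η A b → η A A
  η-individual {A} {b} A∈b with to (ontology A b) A∈b
  ... | inhabited , unique , _ = from (ontology A A) (inhabited , unique , λ _ C∈A → C∈A)

  η-sym : ∀ {A B} → η A B → η B B → η B A
  η-sym {A} {B} A∈B B∈B = proj₁ (proj₂ (to (ontology B B) B∈B)) B A B∈B A∈B

  pt-resp-η : ∀ {A B C} → η A B → η B B → η C (pt A) → η C (pt B)
  pt-resp-η {A} {B} {C} A∈B B∈B C∈ptA = pt-trans C A B C∈ptA (η-trans A∈B (pt-refl B B∈B))

  ext-resp-η : ∀ {S K} → η S K → η K K → ext K ≈ ext S
  ext-resp-η {S} {K} S∈K K∈K X = mk⇔ (move (η-sym S∈K K∈K) (η-individual S∈K)) (move S∈K K∈K)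
    where
    move : ∀ {A B} → η A B → η B B → η X (ext A) → η X (ext B)
    move {A} {B} A∈B B∈B X∈extA with to (ext-def X A) X∈extA
    ... | X∈X , _ , disjoint = from (ext-def X B)
          (X∈X , B∈B , λ { (C , C∈ptX , C∈ptB) → disjoint (C , C∈ptX , pt-resp-η B∈A A∈A C∈ptB) })
      where
      B∈A : η B A
      B∈A = η-sym A∈B B∈B

      A∈A : η A A
      A∈A = η-individual A∈B

  ∩-congʳ : ∀ {a b c} → b ≈ c → (a ∩ b) ≈ (a ∩ c)
  ∩-congʳ {a} {b} {c} b≈c P = mk⇔
    (λ P∈ab → let (P∈a , P∈b) = to (∩-def P a b) P∈ab in from (∩-def P a c) (P∈a , to (b≈c P) P∈b))
    (λ P∈ac → let (P∈a , P∈c) = to (∩-def P a c) P∈ac in from (∩-def P a b) (P∈a , from (b≈c P) P∈c))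

  klass-resp-≈ : ∀ {a b A} → a ≈ b → η A (klass a) → η A (klass b)
  klass-resp-≈ {a} {b} {A} a≈b A∈klass with to (klass-def A a) A∈klass
  ... | A∈A , covers , overlaps = from (klass-def A b)
        (A∈A , (λ B B∈b → covers B (from (a≈b B) B∈b)) ,
         λ B B∈ptA → let (C , D , C∈a , D∈ptC , D∈ptB) = overlaps B B∈ptA
                     in C , D , to (a≈b C) C∈a , D∈ptC , D∈ptB)

  compl-resp-η : ∀ {S K X} → η S K → η K K → η X (compl K) → η X (compl S)
  compl-resp-η {S} {K} {X} S∈K K∈K X∈complK with to (compl-def X K) X∈complK
  ... | K∈ptU , X∈klass = from (compl-def X S)
        (η-trans S∈K K∈ptU , klass-resp-≈ (∩-congʳ (ext-resp-η S∈K K∈K)) X∈klass)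

  compl-unique : ∀ {S P P′} → η P (compl S) → η P′ (compl S) → η P P′
  compl-unique {S} {P} {P′} P∈complS P′∈complS =
    klass-unique _ P P′ (proj₂ (to (compl-def P S) P∈complS)) (proj₂ (to (compl-def P′ S) P′∈complS))

  compl-irrefl : ∀ P → ¬ η P (compl P)
  compl-irrefl P P∈complP with to (klass-def P _) (proj₂ (to (compl-def P P) P∈complP))
  ... | P∈P , _ , overlaps with overlaps P (pt-refl P P∈P)
  ... | C , D , C∈ptU∩extP , D∈ptC , D∈ptP =
        proj₂ (proj₂ (to (ext-def C P) (proj₂ (to (∩-def C _ _) C∈ptU∩extP)))) (D , D∈ptC , D∈ptP)

  closure⇒compl-compl : ∀ {P Q} → η P (closure Q) → ∃ λ S → η S (compl Q) × η P (compl S)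
  closure⇒compl-compl {P} {Q} P∈closure with to (closure-def P Q) P∈closure
  ... | _ , R , S , R∈complQ , S∈intR , P∈complS =
        S , η-trans (proj₂ (to (interior-def S R) S∈intR)) R∈complQ , P∈complS

  boundaryM-empty : ∀ Q P → ¬ η P (boundaryM Q)
  boundaryM-empty Q P P∈boundary
    with to (∩-def P _ _) (proj₂ (to (boundaryM-def P Q) P∈boundary))
  ... | P∈closureQ , P∈closureComplQ
    with closure⇒compl-compl P∈closureQ | closure⇒compl-compl P∈closureComplQ
  ... | S , S∈complQ , P∈complS | S′ , S′∈complComplQ , P∈complS′ =
        compl-irrefl P (compl-resp-η P∈S′ (η-individual S′∈complS) P∈complS′)
    where
    complQ-individual : η (compl Q) (compl Q)
    complQ-individual = proj₁ (to (closure-def P (compl Q)) P∈closureComplQ)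

    S′∈complS : η S′ (compl S)
    S′∈complS = compl-resp-η S∈complQ complQ-individual S′∈complComplQ

    P∈S′ : η P S′
    P∈S′ = compl-unique P∈complS S′∈complS

  empty⇒≈Λ : ∀ {a} → (∀ P → ¬ η P a) → a ≈ Λ
  empty⇒≈Λ a-empty P = mk⇔ (λ P∈a → ⊥-elim (a-empty P P∈a)) (λ P∈Λ → ⊥-elim (Λ-def P P∈Λ))

theorem2 : (M : Mereology) → let open Mereology M in
    ∀ Q → η Q Q → ¬ (Q ≡ₙ Universe) → boundaryM Q ≈ Λ
theorem2 M Q _ _ = empty⇒≈Λ M (boundaryM-empty M Q)
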